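{- Let $G$ be a finite simple connected graph with at least one edge such that $\chi(G) = \Delta(G)$ and ${\rm vs}_{\chi}(G) = 1$. Then there exists a vertex $v \in V(G)$ such that $d_G(v) = \Delta(G)$ and $\chi(G - v) = \Delta(G) - 1$.
   Context: $\chi(G)$ is the chromatic number, $\Delta(G)$ the maximum degree, and $d_G(v)$ the degree of $v$ in $G$. The chromatic vertex stability number ${\rm vs}_{\chi}(G)$ is the minimum number of vertices of $G$ whose deletion results in a graph $H$ with $\chi(H) = \chi(G)-1$. -}

module Defs where

open import Data.Nat using (ℕ; zero; suc; _≤_; _⊔_; _∸_)
open import Data.Bool using (Bool; true; false; if_then_else_)
open import Data.Fin using (Fin)
open import Data.Fin.Subset using (Subset; _∈_; _∉_; ∣_∣) renaming (⊥ to ⊥S)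
open import Data.List using (List; map; foldr; allFin)
open import Data.Nat.ListAction using (sum)
open import Data.Product using (Σ; _×_; ∃)
open import Relation.Binary.PropositionalEquality using (_≡_; _≢_)

record SimpleGraph (n : ℕ) : Set where
  field
    Adj    : Fin n → Fin n → Bool
    sym    : ∀ i j → Adj i j ≡ Adj j i
    irrefl : ∀ i → Adj i i ≡ false
open SimpleGraph public

module _ {n : ℕ} (G : SimpleGraph n) where

  degree : Fin n → ℕ
  degree v = sum (map (λ j → if Adj G v j then 1 else 0) (allFin n))

  -- Δ(G): maximum degree (0 for the empty vertex set)
  maxDegree : ℕ
  maxDegree = foldr _⊔_ 0 (map degree (allFin n))

  HasEdge : Set
  HasEdge = ∃ λ u → ∃ λ v → Adj G u v ≡ true

  data Reachable : Fin n → Fin n → Set where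
    here : ∀ {u} → Reachable u u
    step : ∀ {u w v} → Adj G u w ≡ true → Reachable w v → Reachable u v

  Connected : Set
  Connected = ∀ u v → Reachable u v

  -- Proper k-colourings of G - X (the graph obtained by deleting the vertex set X):
  -- colours are assigned only to the remaining vertices.
  ProperColouringMinus : (X : Subset n) (k : ℕ) → ((i : Fin n) → i ∉ X → Fin k) → Set
  ProperColouringMinus X k c =
    ∀ i j (i∉X : i ∉ X) (j∉X : j ∉ X) → Adj G i j ≡ true → c i i∉X ≢ c j j∉X

  ColourableMinus : Subset n → ℕ → Set
  ColourableMinus X k = Σ ((i : Fin n) → i ∉ X → Fin k) (ProperColouringMinus X k)

  ChromaticNumberMinus : Subset n → ℕ → Set
  ChromaticNumberMinus X k = ColourableMinus X k × (∀ m → ColourableMinus X m → k ≤ m)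

  ChromaticNumber : ℕ → Set
  ChromaticNumber k = ChromaticNumberMinus ⊥S k

  VertexStabilityNumber : ℕ → Set
  VertexStabilityNumber s =
    ∀ k → ChromaticNumber k →
      (Σ (Subset n) λ X → ∣ X ∣ ≡ s × ChromaticNumberMinus X (k ∸ 1))
      × (∀ X → ChromaticNumberMinus X (k ∸ 1) → s ≤ ∣ X ∣)

-- Suppose χ(G - v) = Δ - 1 and d(v) < Δ. In a (Δ - 1)-colouring of G - v every colour
-- occurs on N(v), for a missing colour could be given to v, contradicting χ(G) = Δ; as
-- |N(v)| ≤ Δ - 1, each colour occurs there exactly once. Hence giving v the colour of any
-- neighbour u yields a (Δ - 1)-colouring of G - u. Starting from the vertex v₀ with
-- χ(G - v₀) = Δ - 1 provided by vs_χ(G) = 1, this property travels along a path from v₀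
-- to a vertex of maximum degree until it reaches a vertex of degree Δ.
module Submission where

open import Defs hiding (sym)
open import Data.Bool using (Bool; true; false; if_then_else_) renaming (_≟_ to _≟ᵇ_)
open import Data.Fin using (Fin; zero; suc; _≟_)
open import Data.Fin.Properties using (any?; injective⇒≤) renaming (suc-injective to suc-injectiveᶠ)
open import Data.Fin.Subset using (Subset; ⁅_⁆; _∉_; ∣_∣; inside; outside) renaming (⊥ to ∅)
open import Data.Fin.Subset.Properties using (x≢y⇒x∉⁅y⁆; x∉⁅y⁆⇒x≢y; ∉⊥)
open import Data.List using (List; []; _∷_; map; foldr; allFin; filter; length; lookup)
open import Data.List.Membership.Propositional using (_∈_)
open import Data.List.Membership.Propositional.Properties
  using (∈-filter⁺; ∈-allFin; ∈-map⁻; foldr-selective)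
open import Data.List.Properties using (foldr-forcesᵇ)
open import Data.List.Relation.Unary.All using (All) renaming (lookup to lookupᴬ)
open import Data.List.Relation.Unary.All.Properties using (map⁻)
open import Data.List.Relation.Unary.Any using (index)
open import Data.List.Relation.Unary.Any.Properties using (lookup-index)
open import Data.Nat using (ℕ; zero; suc; _≤_; _⊔_; _∸_; _≤?_)
open import Data.Nat.ListAction using (sum)
open import Data.Nat.Properties
  using (⊔-sel; m⊔n≤o⇒m≤o; m⊔n≤o⇒n≤o; ≤-refl; ≤-trans; ≤-antisym; ≤-reflexive; ≰⇒>; 1+n≰n; ∸-monoˡ-≤; suc-injective)
open import Data.Product using (∃; _×_; _,_; proj₁; proj₂)
open import Data.Vec using () renaming ([] to []ᵛ; _∷_ to _∷ᵛ_)
open import Data.Sum using (_⊎_; inj₁; inj₂)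
open import Function using (_∘_)
open import Function.Definitions using (Injective)
open import Relation.Nullary using (¬_; yes; no; contradiction)
open import Relation.Nullary.Decidable using (_×-dec_)
open import Relation.Binary.PropositionalEquality
  using (_≡_; _≢_; refl; sym; trans; cong; subst; module ≡-Reasoning)

private
  variable
    m n : ℕ

∣p∣≡0⇒p≡⊥ : (p : Subset n) → ∣ p ∣ ≡ 0 → p ≡ ∅
∣p∣≡0⇒p≡⊥ []ᵛ            _     = refl
∣p∣≡0⇒p≡⊥ (outside ∷ᵛ p) ∣p∣≡0 = cong (outside ∷ᵛ_) (∣p∣≡0⇒p≡⊥ p ∣p∣≡0)

∣p∣≡1⇒p≡⁅x⁆ : (p : Subset n) → ∣ p ∣ ≡ 1 → ∃ λ x → p ≡ ⁅ x ⁆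
∣p∣≡1⇒p≡⁅x⁆ (inside  ∷ᵛ p) ∣p∣≡1 = zero , cong (inside ∷ᵛ_) (∣p∣≡0⇒p≡⊥ p (suc-injective ∣p∣≡1))
∣p∣≡1⇒p≡⁅x⁆ (outside ∷ᵛ p) ∣p∣≡1 with ∣p∣≡1⇒p≡⁅x⁆ p ∣p∣≡1
... | x , refl = suc x , refl

sum-indicator≡length-filter : (b : Fin n → Bool) (xs : List (Fin n)) →
  sum (map (λ j → if b j then 1 else 0) xs) ≡ length (filter (λ j → b j ≟ᵇ true) xs)
sum-indicator≡length-filter b []       = refl
sum-indicator≡length-filter b (x ∷ xs) with b x
... | true  = cong suc (sum-indicator≡length-filter b xs)
... | false = sum-indicator≡length-filter b xs

foldr-⊔-upperBound : (xs : List ℕ) → All (_≤ foldr _⊔_ 0 xs) xs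
foldr-⊔-upperBound xs = foldr-forcesᵇ (λ x y x⊔y≤ → m⊔n≤o⇒m≤o x y x⊔y≤ , m⊔n≤o⇒n≤o x y x⊔y≤) 0 xs ≤-refl

fillAt : {A : Set} (v : Fin n) → ((i : Fin n) → i ∉ ⁅ v ⁆ → A) → A → Fin n → A
fillAt v c a i with i ≟ v
... | yes _   = a
... | no i≢v = c i (x≢y⇒x∉⁅y⁆ i≢v)

fillAt-at : {A : Set} (v : Fin n) (c : (i : Fin n) → i ∉ ⁅ v ⁆ → A) (a : A) → fillAt v c a v ≡ a
fillAt-at v c a with v ≟ v
... | yes _   = refl
... | no v≢v = contradiction refl v≢v

fillAt-away : {A : Set} {v i : Fin n} (c : (i : Fin n) → i ∉ ⁅ v ⁆ → A) (a : A) →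
              (i≢v : i ≢ v) → fillAt v c a i ≡ c i (x≢y⇒x∉⁅y⁆ i≢v)
fillAt-away {v = v} {i} c a i≢v with i ≟ v
... | yes i≡v = contradiction i≡v i≢v
... | no _    = refl

module _ (G : SimpleGraph n) where

  adj⇒≢ : ∀ {i j} → Adj G i j ≡ true → i ≢ j
  adj⇒≢ {i} adj refl = contradiction (trans (sym adj) (irrefl G i)) λ ()

  adj-sym : ∀ {i j} → Adj G i j ≡ true → Adj G j i ≡ true
  adj-sym {i} {j} adj = trans (SimpleGraph.sym G j i) adj

  injection⇒≤degree : ∀ v (g : Fin m → Fin n) → Injective _≡_ _≡_ g →
                      (∀ a → Adj G v (g a) ≡ true) → m ≤ degree G v
  injection⇒≤degree {m} v g g-injective g-adj =
    subst (m ≤_) (sym (sum-indicator≡length-filter (Adj G v) (allFin n))) (injective⇒≤ h-injective)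
    where
    neighbours : List (Fin n)
    neighbours = filter (λ j → Adj G v j ≟ᵇ true) (allFin n)

    g∈neighbours : ∀ a → g a ∈ neighbours
    g∈neighbours a = ∈-filter⁺ (λ j → Adj G v j ≟ᵇ true) (∈-allFin (g a)) (g-adj a)

    h : Fin m → Fin (length neighbours)
    h a = index (g∈neighbours a)

    h-injective : Injective _≡_ _≡_ h
    h-injective {a} {b} ha≡hb = g-injective (begin
      g a                        ≡⟨ lookup-index (g∈neighbours a) ⟩
      lookup neighbours (h a)    ≡⟨ cong (lookup neighbours) ha≡hb ⟩
      lookup neighbours (h b)    ≡⟨ lookup-index (g∈neighbours b) ⟨
      g b                        ∎)
      where open ≡-Reasoning

  degree≤maxDegree : ∀ v → degree G v ≤ maxDegree G
  degree≤maxDegree v =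
    lookupᴬ (map⁻ (foldr-⊔-upperBound (map (degree G) (allFin n)))) (∈-allFin v)

  maxDegree-attained : maxDegree G ≡ 0 ⊎ ∃ λ v → degree G v ≡ maxDegree G
  maxDegree-attained with foldr-selective ⊔-sel 0 (map (degree G) (allFin n))
  ... | inj₁ Δ≡0 = inj₁ Δ≡0
  ... | inj₂ Δ∈  with ∈-map⁻ (degree G) Δ∈
  ...   | v , _ , Δ≡dv = inj₂ (v , sym Δ≡dv)

  Proper : (Fin n → Fin m) → Set
  Proper f = ∀ {i j} → Adj G i j ≡ true → f i ≢ f j

  ProperExcept : Fin n → (Fin n → Fin m) → Set
  ProperExcept v f = ∀ {i j} → i ≢ v → j ≢ v → Adj G i j ≡ true → f i ≢ f j

  proper⇒colourable : {f : Fin n → Fin m} → Proper f → ColourableMinus G ∅ m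
  proper⇒colourable {f = f} f-proper = (λ i _ → f i) , λ i j _ _ → f-proper

  properExcept⇒colourableMinus : ∀ {v} {f : Fin n → Fin m} → ProperExcept v f → ColourableMinus G ⁅ v ⁆ m
  properExcept⇒colourableMinus {f = f} f-proper =
    (λ i _ → f i) , λ i j i∉ j∉ → f-proper (x∉⁅y⁆⇒x≢y i∉) (x∉⁅y⁆⇒x≢y j∉)

  fillAt-properExcept : ∀ {v} {c : (i : Fin n) → i ∉ ⁅ v ⁆ → Fin m} →
                        ProperColouringMinus G ⁅ v ⁆ m c → ∀ a → ProperExcept v (fillAt v c a)
  fillAt-properExcept {c = c} c-proper a {i} {j} i≢v j≢v adj
    rewrite fillAt-away c a i≢v | fillAt-away c a j≢v = c-proper i j _ _ adj

  fillAt-proper : ∀ {v} {c : (i : Fin n) → i ∉ ⁅ v ⁆ → Fin m} → ProperColouringMinus G ⁅ v ⁆ m c →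
                  ∀ {a} → (∀ {w} (w≢v : w ≢ v) → Adj G v w ≡ true → c w (x≢y⇒x∉⁅y⁆ w≢v) ≢ a) →
                  Proper (fillAt v c a)
  fillAt-proper {v = v} c-proper a-free {i} {j} adj with i ≟ v | j ≟ v
  ... | yes refl | yes refl = contradiction refl (adj⇒≢ adj)
  ... | yes refl | no j≢v   = λ a≡cj → a-free j≢v adj (sym a≡cj)
  ... | no i≢v   | yes refl = a-free i≢v (adj-sym adj)
  ... | no i≢v   | no j≢v   = c-proper i j _ _ adj

  colourableMinus⁅x⁆⇒colourable : ∀ {x} → ColourableMinus G ⁅ x ⁆ m → ColourableMinus G ∅ (suc m)
  colourableMinus⁅x⁆⇒colourable (c , c-proper) =
    proper⇒colourable (fillAt-proper (λ i j i∉ j∉ adj → c-proper i j i∉ j∉ adj ∘ suc-injectiveᶠ) {zero} λ _ _ ())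

  chromaticNumberMinus⁅x⁆ : ∀ {k x} → ChromaticNumber G k → ColourableMinus G ⁅ x ⁆ (k ∸ 1) →
                            ChromaticNumberMinus G ⁅ x ⁆ (k ∸ 1)
  chromaticNumberMinus⁅x⁆ (_ , minimal) col =
    col , λ m col′ → ∸-monoˡ-≤ 1 (minimal (suc m) (colourableMinus⁅x⁆⇒colourable col′))

  module _ (uncolourable : ¬ ColourableMinus G ∅ m) {v} {f : Fin n → Fin m} (f-proper : ProperExcept v f) where

    every-colour-on-neighbourhood : ∀ a → ∃ λ w → Adj G v w ≡ true × f w ≡ a
    every-colour-on-neighbourhood a with any? (λ w → (Adj G v w ≟ᵇ true) ×-dec (f w ≟ a))
    ... | yes found = found
    ... | no absent = contradiction
      (proper⇒colourable (fillAt-proper (proj₂ (properExcept⇒colourableMinus f-proper)) {a}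
                                        λ _ vw fw≡a → absent (_ , vw , fw≡a)))
      uncolourable

    -- With every colour on N(v) and |N(v)| ≤ m, a repeated colour would give m + 1 neighbours.
    neighbour-colours-injective : degree G v ≤ m → ∀ {u w} → Adj G v u ≡ true → Adj G v w ≡ true →
                                  f u ≡ f w → u ≡ w
    neighbour-colours-injective deg≤m {u} {w} vu vw fu≡fw with u ≟ w
    ... | yes u≡w = u≡w
    ... | no  u≢w = contradiction (≤-trans (injection⇒≤degree v h h-injective h-adj) deg≤m) 1+n≰n
      where
      pick : Fin m → Fin n
      pick a with a ≟ f u
      ... | yes _ = u
      ... | no  _ = proj₁ (every-colour-on-neighbourhood a)

      pick-adj : ∀ a → Adj G v (pick a) ≡ true
      pick-adj a with a ≟ f u
      ... | yes _ = vu
      ... | no  _ = proj₁ (proj₂ (every-colour-on-neighbourhood a))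

      f∘pick : ∀ a → f (pick a) ≡ a
      f∘pick a with a ≟ f u
      ... | yes a≡fu = sym a≡fu
      ... | no  _    = proj₂ (proj₂ (every-colour-on-neighbourhood a))

      pick-fu : pick (f u) ≡ u
      pick-fu with f u ≟ f u
      ... | yes _     = refl
      ... | no  fu≢fu = contradiction refl fu≢fu

      w≢pick : ∀ a → w ≢ pick a
      w≢pick a w≡pick = u≢w (begin
        u                ≡⟨ pick-fu ⟨
        pick (f u)       ≡⟨ cong pick (trans fu≡fw (trans (cong f w≡pick) (f∘pick a))) ⟩
        pick a           ≡⟨ w≡pick ⟨
        w                ∎)
        where open ≡-Reasoning

      h : Fin (suc m) → Fin n
      h zero    = w
      h (suc a) = pick a

      h-adj : ∀ a → Adj G v (h a) ≡ true
      h-adj zero    = vw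
      h-adj (suc a) = pick-adj a

      h-injective : Injective _≡_ _≡_ h
      h-injective {zero}  {zero}  _ = refl
      h-injective {zero}  {suc b} e = contradiction e (w≢pick b)
      h-injective {suc a} {zero}  e = contradiction (sym e) (w≢pick a)
      h-injective {suc a} {suc b} e = cong suc (trans (sym (f∘pick a)) (trans (cong f e) (f∘pick b)))

    recolour-at-neighbour : degree G v ≤ m → ∀ {u} → Adj G v u ≡ true → f v ≡ f u → ProperExcept u f
    recolour-at-neighbour deg≤m {u} vu fv≡fu {i} {j} i≢u j≢u adj with i ≟ v | j ≟ v
    ... | yes refl | yes refl = contradiction refl (adj⇒≢ adj)
    ... | yes refl | no  _    = λ fv≡fj →
      j≢u (sym (neighbour-colours-injective deg≤m vu adj (trans (sym fv≡fu) fv≡fj)))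
    ... | no  _    | yes refl = λ fi≡fv →
      i≢u (sym (neighbour-colours-injective deg≤m vu (adj-sym adj) (trans (sym fv≡fu) (sym fi≡fv))))
    ... | no  i≢v  | no  j≢v  = f-proper i≢v j≢v adj

  colourableMinus⁅x⁆-step : ¬ ColourableMinus G ∅ m → ∀ {v u} → degree G v ≤ m → Adj G v u ≡ true →
                            ColourableMinus G ⁅ v ⁆ m → ColourableMinus G ⁅ u ⁆ m
  colourableMinus⁅x⁆-step uncolourable {v} {u} deg≤m vu (c , c-proper) =
    properExcept⇒colourableMinus
      (recolour-at-neighbour uncolourable (fillAt-properExcept c-proper cu) deg≤m vu
        (trans (fillAt-at v c cu) (sym (fillAt-away c cu u≢v))))
    where
    u≢v : u ≢ v
    u≢v = adj⇒≢ (adj-sym vu)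

    cu : Fin _
    cu = c u (x≢y⇒x∉⁅y⁆ u≢v)

  colourableMinus⁅x⁆-reaches-degree> : ¬ ColourableMinus G ∅ m → ∀ {v w} → Reachable G v w →
    suc m ≤ degree G w → ColourableMinus G ⁅ v ⁆ m → ∃ λ x → suc m ≤ degree G x × ColourableMinus G ⁅ x ⁆ m
  colourableMinus⁅x⁆-reaches-degree> uncolourable {v} here m<dw col = v , m<dw , col
  colourableMinus⁅x⁆-reaches-degree> {m} uncolourable {v} (step vu u⇝w) m<dw col with degree G v ≤? m
  ... | yes deg≤m = colourableMinus⁅x⁆-reaches-degree> uncolourable u⇝w m<dw
                      (colourableMinus⁅x⁆-step uncolourable deg≤m vu col)
  ... | no  deg≰m = v , ≰⇒> deg≰m , col

lemma2p2 : ∀ {n : ℕ} (G : SimpleGraph n) → Connected G → HasEdge G →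
    ∀ k → ChromaticNumber G k → k ≡ maxDegree G → VertexStabilityNumber G 1 →
    ∃ λ (v : Fin n) → degree G v ≡ maxDegree G
    × ChromaticNumberMinus G ⁅ v ⁆ (maxDegree G ∸ 1)
lemma2p2 G _ (u , _) zero ((c , _) , _) _ _ with () ← c u ∉⊥
lemma2p2 G connected _ (suc m) χ k≡Δ stability
  with (X , ∣X∣≡1 , χ[G-X]) , _ ← stability (suc m) χ
  with v₀ , refl ← ∣p∣≡1⇒p≡⁅x⁆ X ∣X∣≡1
  with maxDegree-attained G
... | inj₁ Δ≡0 = contradiction (trans k≡Δ Δ≡0) λ ()
... | inj₂ (w , dw≡Δ)
  with x , m<dx , col ← colourableMinus⁅x⁆-reaches-degree> G (λ col → 1+n≰n (proj₂ χ m col))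
                          (connected v₀ w) (≤-reflexive (trans k≡Δ (sym dw≡Δ))) (proj₁ χ[G-X])
  = x , dx≡Δ , subst (λ k → ChromaticNumberMinus G ⁅ x ⁆ (k ∸ 1)) k≡Δ (chromaticNumberMinus⁅x⁆ G χ col)
  where
  dx≡Δ : degree G x ≡ maxDegree G
  dx≡Δ = ≤-antisym (degree≤maxDegree G x) (subst (_≤ degree G x) k≡Δ m<dx)
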